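{- Let $G$ be a graph in $\varepsilon_1$. Then every block of $G$ is a cycle $C_n$ with $n\equiv 1 \pmod 4$.
   Context: All graphs are finite, simple, undirected and connected. An Euler graph is a connected graph in which every vertex has even degree. $\varepsilon_1$ denotes the class of Euler graphs $G$ such that every cycle of $G$ has length $n\equiv 1 \pmod 4$. A block is a maximal connected subgraph without cut vertices. -}

module Defs where

open import Data.Nat using (ℕ; zero; suc; _≤_; _%_)
open import Data.Nat.Divisibility using (_∣_)
open import Data.Bool using (Bool; true; false; if_then_else_; _∧_; not)
open import Data.Fin using (Fin; toℕ; _≟_)
open import Data.List using (List; map; allFin)
open import Data.Nat.ListAction using (sum)
open import Data.Product using (Σ; ∃; _×_; _,_)
open import Data.Sum using (_⊎_)
open import Relation.Nullary.Decidable using (⌊_⌋)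
open import Relation.Binary.PropositionalEquality using (_≡_; _≢_)
open import Function.Definitions using (Injective)
open import Function.Bundles using (_⇔_)

record Graph (n : ℕ) : Set where
  field
    adj    : Fin n → Fin n → Bool
    sym    : ∀ i j → adj i j ≡ adj j i
    irrefl : ∀ i → adj i i ≡ false
open Graph public

data Walk {n : ℕ} (E : Fin n → Fin n → Bool) : Fin n → Fin n → Set where
  here : ∀ {u} → Walk E u u
  step : ∀ {u w v} → E u w ≡ true → Walk E w v → Walk E u v

degree : ∀ {n} → Graph n → Fin n → ℕ
degree {n} G i = sum (map (λ j → if adj G i j then 1 else 0) (allFin n))

Connected : ∀ {n} → Graph n → Set
Connected G = ∀ u v → Walk (adj G) u v

Euler : ∀ {n} → Graph n → Set
Euler G = Connected G × (∀ v → 2 ∣ degree G v)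

Consec : (k : ℕ) → Fin k → Fin k → Set
Consec k i j = (suc (toℕ i) ≡ toℕ j) ⊎ ((suc (toℕ i) ≡ k) × (toℕ j ≡ 0))

record Cycle {n : ℕ} (G : Graph n) (k : ℕ) : Set where
  field
    three : 3 ≤ k
    vs    : Fin k → Fin n
    inj   : Injective _≡_ _≡_ vs
    edges : ∀ i j → Consec k i j → adj G (vs i) (vs j) ≡ true

ε₁ : ∀ {n} → Graph n → Set
ε₁ G = Euler G × (∀ k → Cycle G k → k % 4 ≡ 1)

record Subgraph {n : ℕ} (G : Graph n) : Set where
  field
    S      : Fin n → Bool
    F      : Fin n → Fin n → Bool
    Fsym   : ∀ i j → F i j ≡ F j i
    F⊆E    : ∀ i j → F i j ≡ true → adj G i j ≡ true
    F⊆S    : ∀ i j → F i j ≡ true → S i ≡ true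
open Subgraph public

delete : ∀ {n} → (Fin n → Fin n → Bool) → Fin n → Fin n → Fin n → Bool
delete F w i j = F i j ∧ not ⌊ i ≟ w ⌋ ∧ not ⌊ j ≟ w ⌋

SubConnected : ∀ {n} {G : Graph n} → Subgraph G → Set
SubConnected H = ∀ u v → S H u ≡ true → S H v ≡ true → Walk (F H) u v

NoCutVertex : ∀ {n} {G : Graph n} → Subgraph G → Set
NoCutVertex H = ∀ w u v → S H w ≡ true → S H u ≡ true → S H v ≡ true →
  u ≢ w → v ≢ w → Walk (delete (F H) w) u v

_⊑_ : ∀ {n} {G : Graph n} → Subgraph G → Subgraph G → Set
H ⊑ K = (∀ v → S H v ≡ true → S K v ≡ true) ×
        (∀ i j → F H i j ≡ true → F K i j ≡ true)

Block : ∀ {n} {G : Graph n} → Subgraph G → Set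
Block {G = G} H = SubConnected H × NoCutVertex H ×
  ((K : Subgraph G) → H ⊑ K → SubConnected K → NoCutVertex K → K ⊑ H)

IsCycleOfLength : ∀ {n} {G : Graph n} → Subgraph G → ℕ → Set
IsCycleOfLength {n} H k = (3 ≤ k) × Σ (Fin k → Fin n) λ vs →
  Injective _≡_ _≡_ vs ×
  (∀ v → (S H v ≡ true) ⇔ ∃ λ i → vs i ≡ v) ×
  (∀ i j → (F H (vs i) (vs j) ≡ true) ⇔ (Consec k i j ⊎ Consec k j i))

-- The blocks of an Euler graph are 2-edge-connected, so every edge of a block H lies on a cycle C,
-- and H ∪ C is still nonseparable; by maximality C ⊆ H.  Conversely, if H had an edge or a path
-- leaving C and returning to it (an ear), C and the ear would form a theta graph whose three
-- cycles have lengths d₁ + m, m + d₂ and d₁ + d₂; these cannot all be odd, whereas every cycle of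
-- a graph in ε₁ has length ≡ 1 (mod 4).  Since H is nonseparable, every edge of H at C would start
-- such an ear, so H = C.  That every edge of an Euler graph lies on a cycle is a parity argument:
-- if v were unreachable from u in G − uv, the vertices reachable from u would have odd total degree.

module Submission where

open import Defs hiding (sym)
open import Data.Bool using (Bool; true; false; _∧_; _∨_; not; if_then_else_)
import Data.Bool.Properties as Bool
open import Data.Empty using (⊥; ⊥-elim)
open import Data.Fin using (Fin; zero; suc; toℕ; fromℕ<; _≟_)
import Data.Fin.Properties as Fin
open import Data.List using (List; []; _∷_; _++_; _∷ʳ_; length; reverse; [_]; lookup; tabulate)
import Data.List.Properties as List
open import Data.List.Membership.Propositional using (_∈_; _∉_)
open import Data.List.Membership.Propositional.Properties using (∈-++⁺ˡ; ∈-++⁺ʳ; ∈-++⁻; ∈-lookup)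
open import Data.List.Relation.Binary.Disjoint.Propositional using (Disjoint)
import Data.List.Relation.Unary.All as All
import Data.List.Relation.Unary.All.Properties as All
open import Data.List.Relation.Unary.AllPairs using ([]; _∷_)
open import Data.List.Relation.Unary.Any using (here; there; any?; index)
import Data.List.Relation.Unary.Any.Properties as Any
open import Data.List.Relation.Unary.Unique.Propositional using (Unique)
open import Data.List.Relation.Unary.Unique.Propositional.Properties using (++⁺)
open import Data.Nat using (ℕ; zero; suc; _+_; _*_; _≤_; _<_; _%_; z≤n; s≤s)
import Data.Nat as ℕ
open import Data.Nat.DivMod using (%-distribˡ-+; [m+kn]%n≡m%n; m∣n⇒o%n%m≡o%m)
open import Data.Nat.Divisibility using (_∣_; divides; ∣m∣n⇒∣m+n; ∣m+n∣m⇒∣n; ∣1⇒≡1)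
import Data.Nat.ListAction as ListAction
open import Data.Nat.Properties
  using ( +-*-semiring; +-assoc; +-comm; +-identityʳ; +-suc; suc-injective; 0≢1+n; 1+n≢n
        ; ≤-trans; ≤-antisym; ≮⇒≥; n≤1+n)
open import Data.Nat.Tactic.RingSolver using (solve-∀)
open import Algebra.Properties.Semiring.Sum +-*-semiring
  using (sum-syntax; sum-cong-≗; sum-replicate-zero; ∑-distrib-+; *-distribˡ-sum)
open import Data.Product using (Σ; ∃; ∃₂; _×_; _,_; proj₁; proj₂; swap)
open import Data.Sum using (_⊎_; inj₁; inj₂; [_,_]′)
import Data.Sum as Sum
open import Function.Base using (_∘_; id)
open import Function.Bundles using (_⇔_; mk⇔; Equivalence)
open import Function.Definitions using (Injective)
open import Relation.Binary.PropositionalEquality hiding ([_])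
open import Relation.Nullary using (Dec; yes; no; does; ¬_; _×-dec_; _⊎-dec_)
open import Relation.Nullary.Decidable using (map′; ⌊_⌋; dec-true; dec-false; does-⇔)

private
  variable
    n : ℕ
    E E′ : Fin n → Fin n → Bool
    a b c u v w x y z : Fin n

false≢true : false ≢ true
false≢true ()

does⇒ : ∀ {A : Set} (a? : Dec A) → does a? ≡ true → A
does⇒ (yes a) _ = a

-- Lists without repetitions

module _ {A : Set} where

  Unique-++⁻ : ∀ (xs : List A) {ys} → Unique (xs ++ ys) → Unique xs × Unique ys × Disjoint xs ys
  Unique-++⁻ []       u        = [] , u , λ ()
  Unique-++⁻ (x ∷ xs) (x∉ ∷ u) with Unique-++⁻ xs u
  ... | uxs , uys , disjoint = All.++⁻ˡ xs x∉ ∷ uxs , uys , λ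
    { (here refl , v∈ys)  → All.lookup (All.++⁻ʳ xs x∉) v∈ys refl
    ; (there v∈xs , v∈ys) → disjoint (v∈xs , v∈ys) }

  Unique-++-comm : ∀ (xs : List A) {ys} → Unique (xs ++ ys) → Unique (ys ++ xs)
  Unique-++-comm xs u with Unique-++⁻ xs u
  ... | uxs , uys , disjoint = ++⁺ uys uxs (disjoint ∘ swap)

  Unique-∷ʳ⁻ : ∀ (xs : List A) {x} → Unique (xs ∷ʳ x) → x ∉ xs
  Unique-∷ʳ⁻ xs u x∈xs = proj₂ (proj₂ (Unique-++⁻ xs u)) (x∈xs , here refl)

  Unique-reverse : ∀ {xs : List A} → Unique xs → Unique (reverse xs)
  Unique-reverse {[]}     []       = []
  Unique-reverse {x ∷ xs} (x∉ ∷ u) rewrite List.unfold-reverse x xs =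
    ++⁺ (Unique-reverse u) (All.[] ∷ []) λ { (x∈ , here refl) → All.All¬⇒¬Any x∉ (Any.reverse⁻ x∈) }

  lookup-injective : ∀ {xs : List A} → Unique xs → Injective _≡_ _≡_ (lookup xs)
  lookup-injective {x ∷ xs} u        {zero}  {zero}  _  = refl
  lookup-injective {x ∷ xs} (x∉ ∷ _) {zero}  {suc j} eq = ⊥-elim (All.lookup x∉ (∈-lookup j) eq)
  lookup-injective {x ∷ xs} (x∉ ∷ _) {suc i} {zero}  eq = ⊥-elim (All.lookup x∉ (∈-lookup i) (sym eq))
  lookup-injective {x ∷ xs} (_ ∷ u)  {suc i} {suc j} eq = cong suc (lookup-injective u eq)

Unique⇒length≤ : {xs : List (Fin n)} → Unique xs → length xs ≤ n
Unique⇒length≤ u = Fin.injective⇒≤ (lookup-injective u)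

other-element : {xs : List (Fin n)} → Unique xs → 2 ≤ length xs → ∀ w → Σ (Fin n) λ o → o ∈ xs × o ≢ w
other-element {xs = x ∷ y ∷ _} (x∉ ∷ _) _ w with x ≟ w
... | no x≢w   = x , here refl , x≢w
... | yes refl = y , there (here refl) , All.head x∉ ∘ sym
other-element {xs = _ ∷ []} _ (s≤s ()) _

-- Walks

Symmetricᵇ : (Fin n → Fin n → Bool) → Set
Symmetricᵇ E = ∀ i j → E i j ≡ E j i

infixr 5 _++ᵂ_

_++ᵂ_ : Walk E a b → Walk E b c → Walk E a c
here     ++ᵂ q = q
step e p ++ᵂ q = step e (p ++ᵂ q)

departures : Walk {n} E a b → List (Fin n)
departures here               = []
departures (step {u = u} _ p) = u ∷ departures p

vertices : Walk {n} E a b → List (Fin n)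
vertices {b = b} p = departures p ∷ʳ b

departures-++ᵂ : (p : Walk E a b) (q : Walk E b c) → departures (p ++ᵂ q) ≡ departures p ++ departures q
departures-++ᵂ here       q = refl
departures-++ᵂ (step e p) q = cong (_ ∷_) (departures-++ᵂ p q)

length-departures-++ᵂ : (p : Walk E a b) (q : Walk E b c) →
                        length (departures (p ++ᵂ q)) ≡ length (departures p) + length (departures q)
length-departures-++ᵂ p q = trans (cong length (departures-++ᵂ p q)) (List.length-++ (departures p))

vertices-++ᵂ : (p : Walk E a b) (q : Walk E b c) → vertices (p ++ᵂ q) ≡ departures p ++ vertices q
vertices-++ᵂ here       q = refl
vertices-++ᵂ (step e p) q = cong (_ ∷_) (vertices-++ᵂ p q)

length-vertices : (p : Walk E a b) → length (vertices p) ≡ suc (length (departures p))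
length-vertices p = trans (List.length-++ (departures p)) (+-comm (length (departures p)) 1)

∈-departures⇒∈-vertices : (p : Walk E a b) → x ∈ departures p → x ∈ vertices p
∈-departures⇒∈-vertices p = ∈-++⁺ˡ

∈-vertices⁻ : (p : Walk E a b) → x ∈ vertices p → x ∈ departures p ⊎ x ≡ b
∈-vertices⁻ p x∈ with ∈-++⁻ (departures p) x∈
... | inj₁ x∈p        = inj₁ x∈p
... | inj₂ (here x≡b) = inj₂ x≡b

start∈vertices : (p : Walk E a b) → a ∈ vertices p
start∈vertices here       = here refl
start∈vertices (step e p) = here refl

end∈vertices : (p : Walk E a b) → b ∈ vertices p
end∈vertices p = ∈-++⁺ʳ (departures p) (here refl)

1≤length : (p : Walk E a b) → a ≢ b → 1 ≤ length (departures p)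
1≤length here       a≢b = ⊥-elim (a≢b refl)
1≤length (step e p) _   = s≤s z≤n

start∈departures : (p : Walk E a b) → 1 ≤ length (departures p) → a ∈ departures p
start∈departures (step e p) _ = here refl

length≡0⇒start≡end : (p : Walk E a b) → length (departures p) ≡ 0 → a ≡ b
length≡0⇒start≡end here _ = refl

first-step : Walk E a b → a ≢ b → Σ (Fin n) λ w → E a w ≡ true
first-step here               a≢b = ⊥-elim (a≢b refl)
first-step (step {w = w} e _) _   = w , e

edgeless⇒start≡end : ¬ (∃₂ λ x y → E x y ≡ true) → Walk E a b → a ≡ b
edgeless⇒start≡end no-edge here       = refl
edgeless⇒start≡end no-edge (step e _) = ⊥-elim (no-edge (_ , _ , e))

data Traverses {E : Fin n → Fin n → Bool} (x y : Fin n) : Walk E a b → Set where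
  first : {e : E x y ≡ true} {p : Walk E y b} → Traverses x y (step e p)
  later : {e : E a c ≡ true} {p : Walk E c b} → Traverses x y p → Traverses x y (step e p)

Traverses⇒edge : {p : Walk E a b} → Traverses x y p → E x y ≡ true
Traverses⇒edge (first {e = e}) = e
Traverses⇒edge (later t)       = Traverses⇒edge t

Traverses⇒∈departures : {p : Walk E a b} → Traverses x y p → x ∈ departures p
Traverses⇒∈departures first     = here refl
Traverses⇒∈departures (later t) = there (Traverses⇒∈departures t)

Traverses⇒∈vertices : {p : Walk E a b} → Traverses x y p → y ∈ vertices p
Traverses⇒∈vertices (first {p = p}) = there (start∈vertices p)
Traverses⇒∈vertices (later t)       = there (Traverses⇒∈vertices t)

Traverses-++ᵂˡ : {p : Walk E a b} {q : Walk E b c} → Traverses x y p → Traverses x y (p ++ᵂ q)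
Traverses-++ᵂˡ first     = first
Traverses-++ᵂˡ (later t) = later (Traverses-++ᵂˡ t)

Traverses-++ᵂʳ : (p : Walk E a b) {q : Walk E b c} → Traverses x y q → Traverses x y (p ++ᵂ q)
Traverses-++ᵂʳ here       t = t
Traverses-++ᵂʳ (step e p) t = later (Traverses-++ᵂʳ p t)

Traverses-++ᵂ⁻ : (p : Walk E a b) {q : Walk E b c} → Traverses x y (p ++ᵂ q) →
                 Traverses x y p ⊎ Traverses x y q
Traverses-++ᵂ⁻ here       t         = inj₂ t
Traverses-++ᵂ⁻ (step e p) first     = inj₁ first
Traverses-++ᵂ⁻ (step e p) (later t) = Sum.map₁ later (Traverses-++ᵂ⁻ p t)

single-step : (p : Walk E a b) → length (departures p) ≡ 1 → Traverses a b p
single-step (step e here) _ = first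

reverseᵂ : Symmetricᵇ E → Walk E a b → Walk E b a
reverseᵂ s here                       = here
reverseᵂ s (step {u = u} {w = w} e p) = reverseᵂ s p ++ᵂ step (trans (s w u) e) here

vertices-reverseᵂ : (s : Symmetricᵇ E) (p : Walk E a b) → vertices (reverseᵂ s p) ≡ reverse (vertices p)
vertices-reverseᵂ s here               = refl
vertices-reverseᵂ s (step {u = u} e p) = begin
  vertices (reverseᵂ s p ++ᵂ step _ here)  ≡⟨ vertices-++ᵂ (reverseᵂ s p) _ ⟩
  departures (reverseᵂ s p) ++ _ ∷ [ u ]   ≡⟨ List.++-assoc (departures (reverseᵂ s p)) _ _ ⟨
  vertices (reverseᵂ s p) ∷ʳ u             ≡⟨ cong (_∷ʳ u) (vertices-reverseᵂ s p) ⟩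
  reverse (vertices p) ∷ʳ u                ≡⟨ List.unfold-reverse u (vertices p) ⟨
  reverse (u ∷ vertices p)                 ∎
  where open ≡-Reasoning

length-departures-reverseᵂ : (s : Symmetricᵇ E) (p : Walk E a b) →
                             length (departures (reverseᵂ s p)) ≡ length (departures p)
length-departures-reverseᵂ s p = suc-injective (begin
  suc (length (departures (reverseᵂ s p))) ≡⟨ length-vertices (reverseᵂ s p) ⟨
  length (vertices (reverseᵂ s p))         ≡⟨ cong length (vertices-reverseᵂ s p) ⟩
  length (reverse (vertices p))            ≡⟨ List.length-reverse (vertices p) ⟩
  length (vertices p)                      ≡⟨ length-vertices p ⟩
  suc (length (departures p))              ∎)
  where open ≡-Reasoning

mapᵂ : (p : Walk E a b) → (∀ {x y} → Traverses x y p → E′ x y ≡ true) → Walk E′ a b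
mapᵂ here       f = here
mapᵂ (step e p) f = step (f first) (mapᵂ p (f ∘ later))

departures-mapᵂ : (p : Walk E a b) (f : ∀ {x y} → Traverses x y p → E′ x y ≡ true) →
                  departures (mapᵂ p f) ≡ departures p
departures-mapᵂ here       f = refl
departures-mapᵂ (step e p) f = cong (_ ∷_) (departures-mapᵂ p (f ∘ later))

vertices-mapᵂ : (p : Walk E a b) (f : ∀ {x y} → Traverses x y p → E′ x y ≡ true) →
                vertices (mapᵂ p f) ≡ vertices p
vertices-mapᵂ {b = b} p f = cong (_∷ʳ b) (departures-mapᵂ p f)

liftᵂ : (∀ {x y} → E x y ≡ true → E′ x y ≡ true) → Walk E a b → Walk E′ a b
liftᵂ E⊆E′ p = mapᵂ p (E⊆E′ ∘ Traverses⇒edge)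

splitᵂ : (p : Walk E a b) → x ∈ departures p →
         Σ (Walk E a x) λ p₁ → Σ (Walk E x b) λ p₂ → p ≡ p₁ ++ᵂ p₂
splitᵂ (step e p) (here refl) = here , step e p , refl
splitᵂ (step e p) (there x∈) with splitᵂ p x∈
... | p₁ , p₂ , refl = step e p₁ , p₂ , refl

prefixᵂ : (p : Walk E a b) → x ∈ departures p →
          Σ (Walk E a x) λ q → (∀ {u v} → Traverses u v q → Traverses u v p) ×
                               (∀ {u} → u ∈ vertices q → u ∈ departures p)
prefixᵂ (step e p) (here refl) = here , (λ ()) , λ { (here refl) → here refl }
prefixᵂ (step e p) (there x∈) with prefixᵂ p x∈
... | q , q⊆p , vq⊆p = step e q , (λ { first → first ; (later t) → later (q⊆p t) }) ,
                       λ { (here refl) → here refl ; (there u∈) → there (vq⊆p u∈) }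

record Rotation {z : Fin n} (p : Walk E z z) (a : Fin n) : Set where
  field
    walk       : Walk E a a
    ⊆-rotated  : ∀ {x} → x ∈ departures p → x ∈ departures walk
    ⊆-original : ∀ {x} → x ∈ departures walk → x ∈ departures p
    unique     : Unique (departures p) → Unique (departures walk)
    length≡    : length (departures walk) ≡ length (departures p)
    traverses  : ∀ {x y} → Traverses x y walk → Traverses x y p

rotate : (p : Walk E z z) → a ∈ departures p → Rotation p a
rotate p a∈ with splitᵂ p a∈
... | p₁ , p₂ , refl = record
  { walk       = p₂ ++ᵂ p₁
  ; ⊆-rotated  = swap-∈ p₁ p₂
  ; ⊆-original = swap-∈ p₂ p₁
  ; unique     = λ u → subst Unique (sym (departures-++ᵂ p₂ p₁))
                   (Unique-++-comm (departures p₁) (subst Unique (departures-++ᵂ p₁ p₂) u))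
  ; length≡    = trans (length-departures-++ᵂ p₂ p₁)
                   (trans (+-comm (length (departures p₂)) _) (sym (length-departures-++ᵂ p₁ p₂)))
  ; traverses  = [ Traverses-++ᵂʳ p₁ , Traverses-++ᵂˡ ]′ ∘ Traverses-++ᵂ⁻ p₂
  }
  where
    swap-∈ : (q : Walk E u v) (r : Walk E v u) → x ∈ departures (q ++ᵂ r) → x ∈ departures (r ++ᵂ q)
    swap-∈ q r x∈ rewrite departures-++ᵂ q r | departures-++ᵂ r q =
      [ ∈-++⁺ʳ (departures r) , ∈-++⁺ˡ ]′ (∈-++⁻ (departures q) x∈)

Path : Walk E a b → Set
Path p = Unique (vertices p)

Path⇒end∉departures : (p : Walk E a b) → Path p → b ∉ departures p
Path⇒end∉departures p = Unique-∷ʳ⁻ (departures p)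

Path⇒Unique-departures : (p : Walk E a b) → Path p → Unique (departures p)
Path⇒Unique-departures p = proj₁ ∘ Unique-++⁻ (departures p)

Path⇒length≤ : (p : Walk {n} E a b) → Path p → length (departures p) ≤ n
Path⇒length≤ p u = ≤-trans (n≤1+n _) (subst (_≤ _) (length-vertices p) (Unique⇒length≤ u))

Path-step : (e : E a b ≡ true) → a ≢ b → Path {E = E} (step e here)
Path-step _ a≢b = (a≢b All.∷ All.[]) ∷ All.[] ∷ []

Path-reverseᵂ : (s : Symmetricᵇ E) (p : Walk E a b) → Path p → Path (reverseᵂ s p)
Path-reverseᵂ s p u = subst Unique (sym (vertices-reverseᵂ s p)) (Unique-reverse u)

suffixᵂ : (p : Walk E c b) → a ∈ vertices p →
          Σ (Walk E a b) λ q → (∀ {x} → x ∈ vertices q → x ∈ vertices p) × (Path p → Path q)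
suffixᵂ here       (here refl) = here , id , id
suffixᵂ (step e p) (here refl) = step e p , id , id
suffixᵂ (step e p) (there a∈) with suffixᵂ p a∈
... | q , q⊆p , path = q , there ∘ q⊆p , λ { (_ ∷ u) → path u }

toPath : (p : Walk E a b) → Σ (Walk E a b) λ q → Path q × (∀ {x} → x ∈ vertices q → x ∈ vertices p)
toPath here = here , All.[] ∷ [] , id
toPath {a = a} (step e p) with toPath p
... | q , path , q⊆p with any? (a ≟_) (vertices q)
...   | yes a∈q = let (q′ , q′⊆q , path′) = suffixᵂ q a∈q in q′ , path′ path , there ∘ q⊆p ∘ q′⊆q
...   | no a∉q  = step e q , All.¬Any⇒All¬ _ a∉q ∷ path ,
                  λ { (here refl) → here refl ; (there x∈) → there (q⊆p x∈) }

firstHit : (P : Fin n → Bool) (p : Walk E a b) → P b ≡ true →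
           Σ (Fin n) λ c → Σ (Walk E a c) λ q → P c ≡ true × (∀ {x} → x ∈ departures q → P x ≡ false)
firstHit P here Pb = _ , here , Pb , λ ()
firstHit {a = a} P (step e p) Pb with P a in Pa
... | true  = a , here , Pa , λ ()
... | false with firstHit P p Pb
...   | c , q , Pc , off = c , step e q , Pc , λ { (here refl) → Pa ; (there x∈) → off x∈ }

module _ (E : Fin n → Fin n → Bool) where

  walkWithin? : ∀ t x y → Dec (Σ (Walk E x y) λ p → length (departures p) ≤ t)
  walkWithin? t x y with x ≟ y
  ... | yes refl = yes (here , z≤n)
  walkWithin? zero    x y | no x≢y = no λ { (here , _) → x≢y refl ; (step _ _ , ()) }
  walkWithin? (suc t) x y | no x≢y with Fin.any? (λ w → (E x w Bool.≟ true) ×-dec walkWithin? t w y)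
  ... | yes (w , e , p , ≤t) = yes (step e p , s≤s ≤t)
  ... | no ¬next             = no λ { (here , _) → x≢y refl ; (step e p , s≤s ≤t) → ¬next (_ , e , p , ≤t) }

  -- Walks may be shortened to paths, which have fewer than n steps.
  walk? : ∀ x y → Dec (Walk E x y)
  walk? x y = map′ proj₁ (λ p → let (q , path , _) = toPath p in q , Path⇒length≤ q path) (walkWithin? n x y)

-- Past the end of the walk, the position stays at its end vertex.
position : Walk {n} E a b → ℕ → Fin n
position {a = a} here       m       = a
position {a = a} (step e p) zero    = a
position         (step e p) (suc m) = position p m

position-zero : (p : Walk E a b) → position p 0 ≡ a
position-zero here       = refl
position-zero (step e p) = refl

position-end : (p : Walk E a b) → position p (length (departures p)) ≡ b
position-end here       = refl
position-end (step e p) = position-end p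

lookup-departures : (p : Walk E a b) (i : Fin (length (departures p))) →
                    lookup (departures p) i ≡ position p (toℕ i)
lookup-departures (step e p) zero    = refl
lookup-departures (step e p) (suc i) = lookup-departures p i

Traverses-position : (p : Walk E a b) {m : ℕ} → m < length (departures p) →
                     Traverses (position p m) (position p (suc m)) p
Traverses-position (step e p) {zero}  _        = subst (λ y → Traverses _ y (step e p)) (sym (position-zero p)) first
Traverses-position (step e p) {suc m} (s≤s m<) = later (Traverses-position p m<)

position-Traverses : {p : Walk E a b} → Traverses x y p →
                     Σ ℕ λ m → m < length (departures p) × position p m ≡ x × position p (suc m) ≡ y
position-Traverses (first {p = p}) = zero , s≤s z≤n , refl , position-zero p
position-Traverses (later t) with position-Traverses t
... | m , m< , refl , refl = suc m , s≤s m< , refl , refl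

delete-intro : (E : Fin n → Fin n → Bool) → E x y ≡ true → x ≢ w → y ≢ w → delete E w x y ≡ true
delete-intro {x = x} {y = y} {w = w} E e x≢w y≢w rewrite e with x ≟ w | y ≟ w
... | yes x≡w | _       = ⊥-elim (x≢w x≡w)
... | no _    | yes y≡w = ⊥-elim (y≢w y≡w)
... | no _    | no _    = refl

delete-elim : (E : Fin n → Fin n → Bool) → delete E w x y ≡ true → E x y ≡ true × x ≢ w × y ≢ w
delete-elim {w = w} {x = x} {y = y} E d with E x y | x ≟ w | y ≟ w
... | true | no x≢w | no y≢w = refl , x≢w , y≢w

delete-sym : Symmetricᵇ E → Symmetricᵇ (delete E w)
delete-sym {w = w} s x y = cong₂ _∧_ (s x y) (Bool.∧-comm (not ⌊ x ≟ w ⌋) (not ⌊ y ≟ w ⌋))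

delete-mono : (E E′ : Fin n → Fin n → Bool) → (∀ {x y} → E x y ≡ true → E′ x y ≡ true) →
              delete E w x y ≡ true → delete E′ w x y ≡ true
delete-mono E E′ E⊆E′ d = let (e , x≢w , y≢w) = delete-elim E d in delete-intro E′ (E⊆E′ e) x≢w y≢w

avoidingᵂ : (p : Walk E a b) → (∀ {x y} → Traverses x y p → E′ x y ≡ true) →
            (∀ {x} → x ∈ vertices p → x ≢ w) → Walk (delete E′ w) a b
avoidingᵂ {E′ = E′} p f avoids = mapᵂ p λ t → delete-intro E′ (f t)
  (avoids (∈-departures⇒∈-vertices p (Traverses⇒∈departures t))) (avoids (Traverses⇒∈vertices t))

vertices-delete : (E : Fin n → Fin n → Bool) (p : Walk (delete E w) a b) → a ≢ w → x ∈ vertices p → x ≢ w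
vertices-delete E here       a≢w (here refl) = a≢w
vertices-delete E (step e p) a≢w (here refl) = a≢w
vertices-delete E (step e p) _   (there x∈)  = vertices-delete E p (proj₂ (proj₂ (delete-elim E e))) x∈

-- Subgraphs

Nonseparable : {G : Graph n} → Subgraph G → Set
Nonseparable H = SubConnected H × NoCutVertex H

adj⇒≢ : (G : Graph n) → adj G x y ≡ true → x ≢ y
adj⇒≢ G e refl = false≢true (trans (sym (Graph.irrefl G _)) e)

edge? : {G : Graph n} (H : Subgraph G) → Dec (∃₂ λ x y → F H x y ≡ true)
edge? H = Fin.any? λ x → Fin.any? λ y → F H x y Bool.≟ true

⊑-trans : {G : Graph n} {H K L : Subgraph G} → H ⊑ K → K ⊑ L → H ⊑ L
⊑-trans (HK-S , HK-F) (KL-S , KL-F) = (λ v → KL-S v ∘ HK-S v) , (λ i j → KL-F i j ∘ HK-F i j)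

IsCycleOfLength-⊑ : {G : Graph n} {H K : Subgraph G} {k : ℕ} → H ⊑ K → K ⊑ H →
                    IsCycleOfLength K k → IsCycleOfLength H k
IsCycleOfLength-⊑ (HK-S , HK-F) (KH-S , KH-F) (three , vs , inj , S⇔ , F⇔) =
  three , vs , inj ,
  (λ v → mk⇔ (Equivalence.to (S⇔ v) ∘ HK-S v) (KH-S v ∘ Equivalence.from (S⇔ v))) ,
  (λ i j → mk⇔ (Equivalence.to (F⇔ i j) ∘ HK-F _ _) (KH-F _ _ ∘ Equivalence.from (F⇔ i j)))

∨-introˡ : ∀ {p q} → p ≡ true → p ∨ q ≡ true
∨-introˡ refl = refl

∨-introʳ : ∀ {p q} → q ≡ true → p ∨ q ≡ true
∨-introʳ {p} refl = Bool.∨-zeroʳ p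

∨-elim : ∀ {p q} → p ∨ q ≡ true → p ≡ true ⊎ q ≡ true
∨-elim {true}  _ = inj₁ refl
∨-elim {false} q = inj₂ q

module _ {G : Graph n} where

  vertices-inside : (K : Subgraph G) (p : Walk (F K) u v) → S K u ≡ true → x ∈ vertices p → S K x ≡ true
  vertices-inside K here       Su (here refl) = Su
  vertices-inside K (step e p) Su (here refl) = Su
  vertices-inside K (step e p) _  (there x∈)  =
    vertices-inside K p (Subgraph.F⊆S K _ _ (trans (Subgraph.Fsym K _ _) e)) x∈

  -- Unlike NoCutVertex, w may lie outside K.
  walk-avoiding : (K : Subgraph G) → Nonseparable K → ∀ w u v → S K u ≡ true → S K v ≡ true →
                  u ≢ w → v ≢ w → Walk (delete (F K) w) u v
  walk-avoiding K (connected , noCut) w u v Su Sv u≢w v≢w with S K w in Sw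
  ... | true  = noCut w u v Sw Su Sv u≢w v≢w
  ... | false = avoidingᵂ (connected u v Su Sv) Traverses⇒edge λ x∈ x≡w →
    false≢true (trans (sym Sw) (subst (λ y → S K y ≡ true) x≡w (vertices-inside K _ Su x∈)))

  _∪_ : Subgraph G → Subgraph G → Subgraph G
  H ∪ K = record
    { S    = λ v → S H v ∨ S K v
    ; F    = λ x y → F H x y ∨ F K x y
    ; Fsym = λ x y → cong₂ _∨_ (Subgraph.Fsym H x y) (Subgraph.Fsym K x y)
    ; F⊆E  = λ x y e → [ Subgraph.F⊆E H x y , Subgraph.F⊆E K x y ]′ (∨-elim e)
    ; F⊆S  = λ x y e → [ ∨-introˡ ∘ Subgraph.F⊆S H x y , ∨-introʳ ∘ Subgraph.F⊆S K x y ]′ (∨-elim e)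
    }

  ⊑-∪ˡ : (H K : Subgraph G) → H ⊑ (H ∪ K)
  ⊑-∪ˡ H K = (λ _ → ∨-introˡ) , (λ _ _ → ∨-introˡ)

  ⊑-∪ʳ : (H K : Subgraph G) → K ⊑ (H ∪ K)
  ⊑-∪ʳ H K = (λ _ → ∨-introʳ) , (λ _ _ → ∨-introʳ)

  ∪-nonseparable : (H K : Subgraph G) → Nonseparable H → Nonseparable K → ∀ {s t} → s ≢ t →
                   S H s ≡ true → S H t ≡ true → S K s ≡ true → S K t ≡ true → Nonseparable (H ∪ K)
  ∪-nonseparable H K nsH nsK {s} {t} s≢t Hs Ht Ks Kt = connected , noCut
    where
      sym∪ = Subgraph.Fsym (H ∪ K)

      to : ∀ {u} y → S (H ∪ K) u ≡ true → S H y ≡ true → S K y ≡ true → Walk (F (H ∪ K)) u y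
      to {u} y Su Hy Ky with ∨-elim {S H u} Su
      ... | inj₁ Hu = liftᵂ ∨-introˡ (proj₁ nsH u y Hu Hy)
      ... | inj₂ Ku = liftᵂ ∨-introʳ (proj₁ nsK u y Ku Ky)

      connected : SubConnected (H ∪ K)
      connected u v Su Sv = to s Su Hs Ks ++ᵂ reverseᵂ sym∪ (to s Sv Hs Ks)

      to-avoiding : ∀ {u} w y → S (H ∪ K) u ≡ true → S H y ≡ true → S K y ≡ true → u ≢ w → y ≢ w →
                    Walk (delete (F (H ∪ K)) w) u y
      to-avoiding {u} w y Su Hy Ky u≢w y≢w with ∨-elim {S H u} Su
      ... | inj₁ Hu = liftᵂ (delete-mono (F H) (F (H ∪ K)) ∨-introˡ) (walk-avoiding H nsH w u y Hu Hy u≢w y≢w)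
      ... | inj₂ Ku = liftᵂ (delete-mono (F K) (F (H ∪ K)) ∨-introʳ) (walk-avoiding K nsK w u y Ku Ky u≢w y≢w)

      -- Route through whichever of the shared vertices s, t is not deleted.
      noCut : NoCutVertex (H ∪ K)
      noCut w u v _ Su Sv u≢w v≢w with s ≟ w
      ... | no s≢w   = to-avoiding w s Su Hs Ks u≢w s≢w ++ᵂ
                       reverseᵂ (delete-sym sym∪) (to-avoiding w s Sv Hs Ks v≢w s≢w)
      ... | yes refl = to-avoiding w t Su Ht Kt u≢w (s≢t ∘ sym) ++ᵂ
                       reverseᵂ (delete-sym sym∪) (to-avoiding w t Sv Ht Kt v≢w (s≢t ∘ sym))

-- Cycles

module _ (p : Walk E z z) where

  private
    L = departures p
    k = length L

  Consec⇒Traverses : ∀ {i j} → Consec k i j → Traverses (lookup L i) (lookup L j) p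
  Consec⇒Traverses {i} {j} i→j =
    subst₂ (λ x y → Traverses x y p) (sym (lookup-departures p i)) (successor i→j)
           (Traverses-position p (Fin.toℕ<n i))
    where
      successor : Consec k i j → position p (suc (toℕ i)) ≡ lookup L j
      successor (inj₁ i+1≡j)         = trans (cong (position p) i+1≡j) (sym (lookup-departures p j))
      successor (inj₂ (i+1≡k , j≡0)) = begin
        position p (suc (toℕ i)) ≡⟨ cong (position p) i+1≡k ⟩
        position p k             ≡⟨ position-end p ⟩
        z                        ≡⟨ position-zero p ⟨
        position p 0             ≡⟨ cong (position p) j≡0 ⟨
        position p (toℕ j)       ≡⟨ lookup-departures p j ⟨
        lookup L j               ∎
        where open ≡-Reasoning

  Traverses⇒Consec : Traverses x y p → ∃₂ λ i j → Consec k i j × lookup L i ≡ x × lookup L j ≡ y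
  Traverses⇒Consec t with position-Traverses t
  ... | m , m<k , refl , refl = fromℕ< m<k , successor
    where
      at : ∀ {m′} (m′<k : m′ < k) → lookup L (fromℕ< m′<k) ≡ position p m′
      at m′<k = trans (lookup-departures p _) (cong (position p) (Fin.toℕ-fromℕ< m′<k))
      successor : ∃ λ j → Consec k (fromℕ< m<k) j × lookup L (fromℕ< m<k) ≡ position p m ×
                                                   lookup L j ≡ position p (suc m)
      successor with suc m ℕ.<? k
      ... | yes m+1<k = fromℕ< m+1<k ,
                        inj₁ (trans (cong suc (Fin.toℕ-fromℕ< m<k)) (sym (Fin.toℕ-fromℕ< m+1<k))) ,
                        at m<k , at m+1<k
      ... | no m+1≮k  = fromℕ< 0<k ,
                        inj₂ (trans (cong suc (Fin.toℕ-fromℕ< m<k)) m+1≡k , Fin.toℕ-fromℕ< 0<k) ,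
                        at m<k ,
                        trans (at 0<k) (trans (position-zero p) (sym (trans (cong (position p) m+1≡k) (position-end p))))
        where
          m+1≡k = ≤-antisym m<k (≮⇒≥ m+1≮k)
          0<k : 0 < k
          0<k = ≤-trans (s≤s z≤n) m<k

module CycleSubgraph {G : Graph n} {k : ℕ} (C : Cycle G k) where

  open Cycle C using (vs; inj; three; edges)

  CycleEdge : Fin n → Fin n → Set
  CycleEdge x y = ∃₂ λ i j → vs i ≡ x × vs j ≡ y × (Consec k i j ⊎ Consec k j i)

  private
    consec? : ∀ i j → Dec (Consec k i j)
    consec? i j = (suc (toℕ i) ℕ.≟ toℕ j) ⊎-dec ((suc (toℕ i) ℕ.≟ k) ×-dec (toℕ j ℕ.≟ 0))

    onCycle? : ∀ v → Dec (∃ λ i → vs i ≡ v)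
    onCycle? v = Fin.any? λ i → vs i ≟ v

    cycleEdge? : ∀ x y → Dec (CycleEdge x y)
    cycleEdge? x y = Fin.any? λ i → Fin.any? λ j →
      (vs i ≟ x) ×-dec (vs j ≟ y) ×-dec (consec? i j ⊎-dec consec? j i)

    flip-edge : ∀ {x y} → CycleEdge x y → CycleEdge y x
    flip-edge (i , j , refl , refl , i~j) = j , i , refl , refl , Sum.swap i~j

    edge⇒adj : ∀ {x y} → CycleEdge x y → adj G x y ≡ true
    edge⇒adj (i , j , refl , refl , inj₁ i→j) = edges i j i→j
    edge⇒adj (i , j , refl , refl , inj₂ j→i) = trans (Graph.sym G _ _) (edges j i j→i)

  subgraph : Subgraph G
  subgraph = record
    { S    = does ∘ onCycle?
    ; F    = λ x y → does (cycleEdge? x y)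
    ; Fsym = λ x y → does-⇔ (mk⇔ flip-edge flip-edge) (cycleEdge? x y) (cycleEdge? y x)
    ; F⊆E  = λ x y → edge⇒adj ∘ does⇒ (cycleEdge? x y)
    ; F⊆S  = λ x y e → let (i , _ , x≡ , _) = does⇒ (cycleEdge? x y) e in dec-true (onCycle? x) (i , x≡)
    }

  S-subgraph⇔ : ∀ {v} → S subgraph v ≡ true ⇔ (∃ λ i → vs i ≡ v)
  S-subgraph⇔ {v} = mk⇔ (does⇒ (onCycle? v)) (dec-true (onCycle? v))

  F-subgraph⇔ : ∀ {x y} → F subgraph x y ≡ true ⇔ CycleEdge x y
  F-subgraph⇔ {x} {y} = mk⇔ (does⇒ (cycleEdge? x y)) (dec-true (cycleEdge? x y))

  subgraph-isCycle : IsCycleOfLength subgraph k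
  subgraph-isCycle = three , vs , inj , (λ _ → S-subgraph⇔) , λ i j → mk⇔
    (λ e → let (i′ , j′ , i′≡ , j′≡ , i~j) = Equivalence.to F-subgraph⇔ e in
      subst₂ (λ i j → Consec k i j ⊎ Consec k j i) (inj i′≡) (inj j′≡) i~j)
    (λ i~j → Equivalence.from F-subgraph⇔ (i , j , refl , refl , i~j))

record ClosedPath {n} (G : Graph n) : Set where
  field
    {base} : Fin n
    walk   : Walk (adj G) base base
    unique : Unique (departures walk)
    long   : 3 ≤ length (departures walk)

  size : ℕ
  size = length (departures walk)

  cycle : Cycle G size
  cycle = record
    { three = long
    ; vs    = lookup (departures walk)
    ; inj   = lookup-injective unique
    ; edges = λ i j → Traverses⇒edge ∘ Consec⇒Traverses walk
    }

  open CycleSubgraph cycle public using (subgraph; subgraph-isCycle)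

  S-subgraph⇔ : S subgraph x ≡ true ⇔ x ∈ departures walk
  S-subgraph⇔ = mk⇔
    (λ Sx → let (i , vi≡x) = Equivalence.to (CycleSubgraph.S-subgraph⇔ cycle) Sx in
      subst (_∈ _) vi≡x (∈-lookup i))
    (λ x∈ → Equivalence.from (CycleSubgraph.S-subgraph⇔ cycle) (index x∈ , sym (Any.lookup-index x∈)))

  Traverses⇒F : Traverses x y walk → F subgraph x y ≡ true
  Traverses⇒F t = let (i , j , i→j , vi≡x , vj≡y) = Traverses⇒Consec walk t in
    Equivalence.from (CycleSubgraph.F-subgraph⇔ cycle) (i , j , vi≡x , vj≡y , inj₁ i→j)

  subgraph-nonseparable : Nonseparable subgraph
  subgraph-nonseparable = connected , noCut
    where
      from-base : S subgraph x ≡ true → Walk (F subgraph) base x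
      from-base Sx = let (q , q⊆walk , _) = prefixᵂ walk (Equivalence.to S-subgraph⇔ Sx) in
        mapᵂ q (Traverses⇒F ∘ q⊆walk)

      connected : SubConnected subgraph
      connected u v Su Sv = reverseᵂ (Subgraph.Fsym subgraph) (from-base Su) ++ᵂ from-base Sv

      -- Read the cycle from w: the rest of it is a path through all other vertices, avoiding w.
      noCut : NoCutVertex subgraph
      noCut w u v Sw Su Sv u≢w v≢w =
        around (Rotation.walk rotation) (Rotation.traverses rotation) (Rotation.unique rotation unique)
               (Rotation.⊆-rotated rotation)
        where
          w∈walk = Equivalence.to S-subgraph⇔ Sw
          rotation = rotate walk w∈walk
          around : (p : Walk (adj G) w w) → (∀ {x y} → Traverses x y p → Traverses x y walk) →
                   Unique (departures p) → (∀ {x} → x ∈ departures walk → x ∈ departures p) →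
                   Walk (delete (F subgraph) w) u v
          around here _ _ walk⊆p with walk⊆p w∈walk
          ... | ()
          around (step {w = x₀} e r) r⊆walk (w∉r ∷ _) walk⊆p =
            reverseᵂ (delete-sym (Subgraph.Fsym subgraph)) (from-x₀ Su u≢w) ++ᵂ from-x₀ Sv v≢w
            where
              from-x₀ : S subgraph x ≡ true → x ≢ w → Walk (delete (F subgraph) w) x₀ x
              from-x₀ Sx x≢w with walk⊆p (Equivalence.to S-subgraph⇔ Sx)
              ... | here x≡w  = ⊥-elim (x≢w x≡w)
              ... | there x∈r = let (q , q⊆r , vq⊆r) = prefixᵂ r x∈r in
                avoidingᵂ q (Traverses⇒F ∘ r⊆walk ∘ later ∘ q⊆r)
                  λ u∈q u≡w → All.lookup w∉r (vq⊆r u∈q) (sym u≡w)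

-- Graphs all of whose cycles are odd

OddCycles : Graph n → Set
OddCycles G = ∀ k → Cycle G k → k % 2 ≡ 1

-- The three cycles of a theta graph with paths of lengths d₁, m, d₂ cannot all be odd.
odd-theta-impossible : ∀ d₁ m d₂ → (d₁ + m) % 2 ≡ 1 → (m + d₂) % 2 ≡ 1 → (d₁ + d₂) % 2 ≡ 1 → ⊥
odd-theta-impossible d₁ m d₂ odd₁ odd₂ odd₃ = 0≢1+n (begin
  (1 + 1) % 2                        ≡⟨ cong₂ (λ x y → (x + y) % 2) odd₁ odd₂ ⟨
  ((d₁ + m) % 2 + (m + d₂) % 2) % 2  ≡⟨ %-distribˡ-+ (d₁ + m) (m + d₂) 2 ⟨
  ((d₁ + m) + (m + d₂)) % 2          ≡⟨ cong (_% 2) (regroup d₁ m d₂) ⟩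
  ((d₁ + d₂) + m * 2) % 2            ≡⟨ [m+kn]%n≡m%n (d₁ + d₂) m 2 ⟩
  (d₁ + d₂) % 2                      ≡⟨ odd₃ ⟩
  1                                  ∎)
  where
    open ≡-Reasoning
    regroup : ∀ d₁ m d₂ → (d₁ + m) + (m + d₂) ≡ (d₁ + d₂) + m * 2
    regroup = solve-∀

3≤+ : ∀ {m d} → 1 ≤ m → 1 ≤ d → (m ≡ 1 → d ≡ 1 → ⊥) → 3 ≤ m + d
3≤+ {suc zero}    {suc zero}    _ _ not-both = ⊥-elim (not-both refl refl)
3≤+ {suc zero}    {suc (suc d)} _ _ _        = s≤s (s≤s (s≤s z≤n))
3≤+ {suc (suc m)} {suc d}       _ _ _        = s≤s (s≤s (subst (1 ≤_) (sym (+-suc m d)) (s≤s z≤n)))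

split-closed : (q₁ : Walk E a b) (q₂ : Walk E b a) → a ≢ b → Unique (departures (q₁ ++ᵂ q₂)) →
               Path q₁ × Path q₂
split-closed q₁ q₂ a≢b u with Unique-++⁻ (departures q₁) (subst Unique (departures-++ᵂ q₁ q₂) u)
... | u₁ , u₂ , disjoint =
  ++⁺ u₁ (All.[] ∷ []) (λ { (b∈q₁ , here refl) → disjoint (b∈q₁ , b∈q₂) }) ,
  ++⁺ u₂ (All.[] ∷ []) (λ { (a∈q₂ , here refl) → disjoint (a∈q₁ , a∈q₂) })
  where
    a∈q₁ = start∈departures q₁ (1≤length q₁ a≢b)
    b∈q₂ = start∈departures q₂ (1≤length q₂ (a≢b ∘ sym))

glue : {G : Graph n} (p : Walk (adj G) a b) (q : Walk (adj G) b a) → Path p → Path q →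
       (∀ {x} → x ∈ vertices p → x ∈ vertices q → x ≡ a ⊎ x ≡ b) →
       3 ≤ length (departures p) + length (departures q) →
       Σ (ClosedPath G) λ c → ClosedPath.size c ≡ length (departures p) + length (departures q)
glue p q path-p path-q meet 3≤ =
  record { walk = p ++ᵂ q ; unique = unique ; long = subst (3 ≤_) (sym size≡) 3≤ } , size≡
  where
    size≡ = length-departures-++ᵂ p q
    only-ends : ∀ {x} → x ≡ _ ⊎ x ≡ _ → x ∈ departures p → x ∈ departures q → ⊥
    only-ends (inj₁ refl) _ a∈q = Path⇒end∉departures q path-q a∈q
    only-ends (inj₂ refl) b∈p _ = Path⇒end∉departures p path-p b∈p
    unique : Unique (departures (p ++ᵂ q))
    unique = subst Unique (sym (departures-++ᵂ p q))
      (++⁺ (Path⇒Unique-departures p path-p) (Path⇒Unique-departures q path-q) λ (x∈p , x∈q) →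
        only-ends (meet (∈-departures⇒∈-vertices p x∈p) (∈-departures⇒∈-vertices q x∈q)) x∈p x∈q)

-- An ear of a cycle: a path between two of its vertices that meets it only at its ends and is not
-- one of its edges.  With the two arcs of the cycle it forms a theta graph.
no-ear : {G : Graph n} → OddCycles G → (c : ClosedPath G) → let open ClosedPath c in
         (p : Walk (adj G) a b) → Path p → a ≢ b → a ∈ departures walk → b ∈ departures walk →
         (∀ {x} → x ∈ vertices p → x ∈ departures walk → x ≡ a ⊎ x ≡ b) →
         (length (departures p) ≡ 1 → ¬ Traverses a b walk × ¬ Traverses b a walk) → ⊥
no-ear {a = a} {b = b} {G = G} odd c p path-p a≢b a∈c b∈c meet not-chord =
  theta R.walk (R.unique unique) R.⊆-original R.traverses R.length≡ (R.⊆-rotated b∈c)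
  where
    open ClosedPath c
    module R = Rotation (rotate walk a∈c)
    m = length (departures p)
    p⁻¹ = reverseᵂ (Graph.sym G) p
    m≡ = length-departures-reverseᵂ (Graph.sym G) p
    odd-size : (c′ : ClosedPath G) {k : ℕ} → ClosedPath.size c′ ≡ k → k % 2 ≡ 1
    odd-size c′ refl = odd _ (ClosedPath.cycle c′)

    theta : (c′ : Walk (adj G) a a) → Unique (departures c′) →
            (∀ {x} → x ∈ departures c′ → x ∈ departures walk) →
            (∀ {x y} → Traverses x y c′ → Traverses x y walk) →
            length (departures c′) ≡ size → b ∈ departures c′ → ⊥
    theta c′ u c′⊆c c′⊆walk size≡ b∈c′ with splitᵂ c′ b∈c′
    ... | q₁ , q₂ , refl = odd-theta-impossible d₁ m d₂
      (odd-size (proj₁ cycle₁) (trans (proj₂ cycle₁) (cong (d₁ +_) m≡)))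
      (odd-size (proj₁ cycle₂) (proj₂ cycle₂))
      (odd-size c (trans (sym size≡) (length-departures-++ᵂ q₁ q₂)))
      where
        d₁ = length (departures q₁)
        d₂ = length (departures q₂)
        paths = split-closed q₁ q₂ a≢b u

        on-c₁ : ∀ {x} → x ∈ vertices q₁ → x ∈ departures walk
        on-c₁ x∈ with ∈-vertices⁻ q₁ x∈
        ... | inj₁ x∈q₁ = c′⊆c (subst (_ ∈_) (sym (departures-++ᵂ q₁ q₂)) (∈-++⁺ˡ x∈q₁))
        ... | inj₂ refl = b∈c

        on-c₂ : ∀ {x} → x ∈ vertices q₂ → x ∈ departures walk
        on-c₂ x∈ with ∈-vertices⁻ q₂ x∈
        ... | inj₁ x∈q₂ =
          c′⊆c (subst (_ ∈_) (sym (departures-++ᵂ q₁ q₂)) (∈-++⁺ʳ (departures q₁) x∈q₂))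
        ... | inj₂ refl = a∈c

        cycle₁ = glue q₁ p⁻¹ (proj₁ paths) (Path-reverseᵂ (Graph.sym G) p path-p)
          (λ x∈q₁ x∈p⁻¹ →
            meet (Any.reverse⁻ (subst (_ ∈_) (vertices-reverseᵂ (Graph.sym G) p) x∈p⁻¹)) (on-c₁ x∈q₁))
          (3≤+ (1≤length q₁ a≢b) (1≤length p⁻¹ (a≢b ∘ sym)) λ d₁≡1 m≡1 →
            proj₁ (not-chord (trans (sym m≡) m≡1)) (c′⊆walk (Traverses-++ᵂˡ (single-step q₁ d₁≡1))))

        cycle₂ = glue p q₂ path-p (proj₂ paths) (λ x∈p x∈q₂ → meet x∈p (on-c₂ x∈q₂))
          (3≤+ (1≤length p a≢b) (1≤length q₂ (a≢b ∘ sym)) λ m≡1 d₂≡1 →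
            proj₂ (not-chord m≡1) (c′⊆walk (Traverses-++ᵂʳ q₁ (single-step q₂ d₂≡1))))

-- A nonseparable subgraph H containing a cycle C of such a graph is C: an edge of H at C that
-- is not an edge of C would start an ear of C.
module _ {G : Graph n} (odd : OddCycles G) (H : Subgraph G) (nonseparable : Nonseparable H)
         (c : ClosedPath G) (C⊑H : ClosedPath.subgraph c ⊑ H) where

  open ClosedPath c
  private
    C = subgraph
    connected = proj₁ nonseparable
    noCut = proj₂ nonseparable

    on-C⇒on-walk : S C x ≡ true → x ∈ departures walk
    on-C⇒on-walk = Equivalence.to S-subgraph⇔

    on-walk⇒on-C : x ∈ departures walk → S C x ≡ true
    on-walk⇒on-C = Equivalence.from S-subgraph⇔

    chord-on-cycle : ∀ {w t} → S C w ≡ true → S C t ≡ true → F H w t ≡ true → F C w t ≡ true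
    chord-on-cycle {w} {t} Cw Ct Hwt with F C w t in Cwt
    ... | true  = refl
    ... | false = ⊥-elim (no-ear odd c (step wt here) (Path-step {E = adj G} wt w≢t) w≢t
                                 (on-C⇒on-walk Cw) (on-C⇒on-walk Ct)
                                 (λ { (here refl) _ → inj₁ refl ; (there (here refl)) _ → inj₂ refl })
                                 λ _ → not-Cwt ∘ Traverses⇒F , not-Cwt ∘ trans (Subgraph.Fsym C w t) ∘ Traverses⇒F)
      where
        wt = Subgraph.F⊆E H w t Hwt
        w≢t = adj⇒≢ G wt
        not-Cwt : F C w t ≡ true → ⊥
        not-Cwt = false≢true ∘ trans (sym Cwt)

    -- If t were off C, a path in H − w from t back to C, cut at its first return, would be an ear.
    stays-on-cycle : ∀ {w t} → S C w ≡ true → F H w t ≡ true → S C t ≡ true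
    stays-on-cycle {w} {t} Cw Hwt with S C t in Ct
    ... | true  = refl
    ... | false = ⊥-elim ear
      where
        t≢w : t ≢ w
        t≢w refl = false≢true (trans (sym Ct) Cw)
        Ht = Subgraph.F⊆S H t w (trans (Subgraph.Fsym H t w) Hwt)

        ear : ⊥
        ear with other-element unique (≤-trans (s≤s (s≤s z≤n)) long) w
        ... | o , o∈walk , o≢w
          with firstHit (S C) (noCut w t o (proj₁ C⊑H w Cw) Ht (proj₁ C⊑H o (on-walk⇒on-C o∈walk)) t≢w o≢w)
                        (on-walk⇒on-C o∈walk)
        ... | c₂ , r , Cc₂ , r-off-C with toPath r
        ... | r₁ , path-r₁ , r₁⊆r =
          no-ear odd c p path-p w≢c₂ (on-C⇒on-walk Cw) (on-C⇒on-walk Cc₂) meet not-chord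
          where
            r-avoids-w : x ∈ vertices r → x ≢ w
            r-avoids-w = vertices-delete (F H) r t≢w
            r′ = liftᵂ (Subgraph.F⊆E H _ _ ∘ proj₁ ∘ delete-elim (F H)) r₁
            r′⊆r : x ∈ vertices r′ → x ∈ vertices r
            r′⊆r = r₁⊆r ∘ subst (_ ∈_) (vertices-mapᵂ r₁ _)
            p = step (Subgraph.F⊆E H w t Hwt) r′
            path-p : Path p
            path-p = All.¬Any⇒All¬ _ (λ w∈r′ → r-avoids-w (r′⊆r w∈r′) refl) ∷
                     subst Unique (sym (vertices-mapᵂ r₁ _)) path-r₁
            w≢c₂ : w ≢ c₂
            w≢c₂ w≡c₂ = r-avoids-w (end∈vertices r) (sym w≡c₂)
            meet : x ∈ vertices p → x ∈ departures walk → x ≡ w ⊎ x ≡ c₂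
            meet (here refl)  _   = inj₁ refl
            meet (there x∈r′) x∈C with ∈-vertices⁻ r (r′⊆r x∈r′)
            ... | inj₁ x∈r  = ⊥-elim (false≢true (trans (sym (r-off-C x∈r)) (on-walk⇒on-C x∈C)))
            ... | inj₂ x≡c₂ = inj₂ x≡c₂
            not-chord : length (departures p) ≡ 1 → ¬ Traverses w c₂ walk × ¬ Traverses c₂ w walk
            not-chord p≡1 = ⊥-elim (false≢true (trans (sym Ct)
              (subst (λ x → S C x ≡ true) (sym (length≡0⇒start≡end r′ (suc-injective p≡1))) Cc₂)))

  nonseparable⊑cycle : H ⊑ C
  nonseparable⊑cycle = on-C , λ x y Hxy → edge-on-C (on-C x (Subgraph.F⊆S H x y Hxy)) Hxy
    where
      edge-on-C : ∀ {w t} → S C w ≡ true → F H w t ≡ true → F C w t ≡ true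
      edge-on-C Cw Hwt = chord-on-cycle Cw (stays-on-cycle Cw Hwt) Hwt
      base-on-C : S C base ≡ true
      base-on-C = on-walk⇒on-C (start∈departures walk (≤-trans (s≤s z≤n) long))
      stays : Walk (F H) u x → S C u ≡ true → S C x ≡ true
      stays here       Cu = Cu
      stays (step e q) Cu = stays q (Subgraph.F⊆S C _ _ (trans (Subgraph.Fsym C _ _) (edge-on-C Cu e)))
      on-C : ∀ x → S H x ≡ true → S C x ≡ true
      on-C x Hx = stays (connected base x (proj₁ C⊑H base base-on-C) Hx) base-on-C

-- Graphs all of whose degrees are even

count : Bool → ℕ
count b = if b then 1 else 0

sum-tabulate : ∀ {n} (f : Fin n → ℕ) → ListAction.sum (tabulate f) ≡ ∑[ i < n ] f i
sum-tabulate {zero}  f = refl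
sum-tabulate {suc n} f = cong (f zero +_) (sum-tabulate (f ∘ suc))

degree≡∑ : (G : Graph n) (x : Fin n) → degree G x ≡ ∑[ j < n ] count (adj G x j)
degree≡∑ G x = trans (cong ListAction.sum (List.map-tabulate id (count ∘ adj G x))) (sum-tabulate (count ∘ adj G x))

∑-single : ∀ {n} (f : Fin n → ℕ) (u : Fin n) → (∀ x → x ≢ u → f x ≡ 0) → ∑[ i < n ] f i ≡ f u
∑-single {suc n} f zero    vanish = trans (cong (f zero +_) (trans
  (sum-cong-≗ (λ i → vanish (suc i) λ ())) (sum-replicate-zero n))) (+-identityʳ (f zero))
∑-single {suc n} f (suc u) vanish = trans (cong (_+ ∑[ i < n ] f (suc i)) (vanish zero λ ()))
  (∑-single (f ∘ suc) u λ x x≢u → vanish (suc x) (x≢u ∘ Fin.suc-injective))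

2∣m+m : ∀ m → 2 ∣ m + m
2∣m+m m = divides m (double m)
  where
    double : ∀ m → m + m ≡ m * 2
    double = solve-∀

∑-even : ∀ {n} (f : Fin n → ℕ) → (∀ i → 2 ∣ f i) → 2 ∣ ∑[ i < n ] f i
∑-even {zero}  f even = divides 0 refl
∑-even {suc n} f even = ∣m∣n⇒∣m+n (even zero) (∑-even (f ∘ suc) (even ∘ suc))

∑∑-symmetric-even : ∀ {n} (A : Fin n → Fin n → ℕ) → (∀ i j → A i j ≡ A j i) → (∀ i → A i i ≡ 0) →
                    2 ∣ ∑[ i < n ] ∑[ j < n ] A i j
∑∑-symmetric-even {zero}  A symmetric diagonal = divides 0 refl
∑∑-symmetric-even {suc n} A symmetric diagonal = subst (2 ∣_) (sym regroup)
  (∣m∣n⇒∣m+n (2∣m+m X)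
    (∑∑-symmetric-even (λ i j → A (suc i) (suc j)) (λ i j → symmetric _ _) (diagonal ∘ suc)))
  where
    X = ∑[ j < n ] A zero (suc j)
    Y = ∑[ i < n ] ∑[ j < n ] A (suc i) (suc j)
    open ≡-Reasoning
    regroup : ∑[ i < suc n ] ∑[ j < suc n ] A i j ≡ (X + X) + Y
    regroup = begin
      (A zero zero + X) + ∑[ i < n ] (A (suc i) zero + ∑[ j < n ] A (suc i) (suc j))
        ≡⟨ cong₂ _+_ (cong (_+ X) (diagonal zero)) (∑-distrib-+ (λ i → A (suc i) zero) _) ⟩
      X + (∑[ i < n ] A (suc i) zero + Y)
        ≡⟨ cong (λ Z → X + (Z + Y)) (sum-cong-≗ λ i → symmetric (suc i) zero) ⟩
      X + (X + Y)
        ≡⟨ +-assoc X X Y ⟨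
      (X + X) + Y ∎

-- The degrees of the vertices in R add up to twice the number of edges inside R plus the number
-- of edges leaving R.
boundary-even : (G : Graph n) → (∀ v → 2 ∣ degree G v) → (R : Fin n → Bool) →
                2 ∣ ∑[ i < n ] ∑[ j < n ] count (R i ∧ not (R j) ∧ adj G i j)
boundary-even {n} G even R =
  ∣m+n∣m⇒∣n (subst (2 ∣_) split (∑-even _ even-in-R)) (∑∑-symmetric-even Inside Inside-sym Inside-diagonal)
  where
    Inside Leaving : Fin n → Fin n → ℕ
    Inside  x y = count (R x ∧ R y ∧ adj G x y)
    Leaving x y = count (R x ∧ not (R y) ∧ adj G x y)

    Inside-sym : ∀ x y → Inside x y ≡ Inside y x
    Inside-sym x y rewrite Graph.sym G x y with R x | R y
    ... | true  | true  = refl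
    ... | true  | false = refl
    ... | false | true  = refl
    ... | false | false = refl

    Inside-diagonal : ∀ x → Inside x x ≡ 0
    Inside-diagonal x rewrite Graph.irrefl G x with R x
    ... | true  = refl
    ... | false = refl

    even-in-R : ∀ x → 2 ∣ count (R x) * degree G x
    even-in-R x with R x
    ... | false = divides 0 refl
    ... | true  = subst (2 ∣_) (sym (+-identityʳ _)) (even x)

    cases : ∀ r s e → count r * count e ≡ count (r ∧ s ∧ e) + count (r ∧ not s ∧ e)
    cases true  true  true  = refl
    cases true  true  false = refl
    cases true  false true  = refl
    cases true  false false = refl
    cases false s     e     = refl

    split : ∑[ i < n ] (count (R i) * degree G i) ≡
            ∑[ i < n ] ∑[ j < n ] Inside i j + ∑[ i < n ] ∑[ j < n ] Leaving i j
    split = begin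
      ∑[ i < n ] (count (R i) * degree G i)
        ≡⟨ sum-cong-≗ (λ i → cong (count (R i) *_) (degree≡∑ G i)) ⟩
      ∑[ i < n ] (count (R i) * ∑[ j < n ] count (adj G i j))
        ≡⟨ sum-cong-≗ (λ i → *-distribˡ-sum (count (R i)) (count ∘ adj G i)) ⟩
      ∑[ i < n ] ∑[ j < n ] (count (R i) * count (adj G i j))
        ≡⟨ sum-cong-≗ (λ i → trans (sum-cong-≗ λ j → cases (R i) (R j) (adj G i j))
                                   (∑-distrib-+ (Inside i) (Leaving i))) ⟩
      ∑[ i < n ] (∑[ j < n ] Inside i j + ∑[ j < n ] Leaving i j)
        ≡⟨ ∑-distrib-+ (λ i → ∑[ j < n ] Inside i j) (λ i → ∑[ j < n ] Leaving i j) ⟩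
      ∑[ i < n ] ∑[ j < n ] Inside i j + ∑[ i < n ] ∑[ j < n ] Leaving i j ∎
      where open ≡-Reasoning

2≤length : (p : Walk E u v) → u ≢ v → E u v ≡ false → 2 ≤ length (departures p)
2≤length here                u≢v _   = ⊥-elim (u≢v refl)
2≤length (step e here)       _   ¬uv = ⊥-elim (false≢true (trans (sym ¬uv) e))
2≤length (step e (step _ _)) _   _   = s≤s (s≤s z≤n)

-- If v were unreachable from u in G − uv, the set R of vertices reachable from u would be left
-- by the single edge uv.
module _ (G : Graph n) (even : ∀ v → 2 ∣ degree G v) {u v : Fin n} (uv : adj G u v ≡ true) where

  private
    IsUV : Fin n → Fin n → Set
    IsUV x y = (x ≡ u × y ≡ v) ⊎ (x ≡ v × y ≡ u)

    isUV? : ∀ x y → Dec (IsUV x y)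
    isUV? x y = ((x ≟ u) ×-dec (y ≟ v)) ⊎-dec ((x ≟ v) ×-dec (y ≟ u))

    swap-UV : ∀ {x y} → IsUV x y → IsUV y x
    swap-UV (inj₁ (x≡u , y≡v)) = inj₂ (y≡v , x≡u)
    swap-UV (inj₂ (x≡v , y≡u)) = inj₁ (y≡u , x≡v)

    G-uv : Fin n → Fin n → Bool
    G-uv x y = adj G x y ∧ not (does (isUV? x y))

    G-uv-sym : Symmetricᵇ G-uv
    G-uv-sym x y = cong₂ (λ e b → e ∧ not b) (Graph.sym G x y)
                         (does-⇔ (mk⇔ swap-UV swap-UV) (isUV? x y) (isUV? y x))

    G-uv-intro : ∀ {x y} → adj G x y ≡ true → ¬ IsUV x y → G-uv x y ≡ true
    G-uv-intro {x} {y} xy ¬uv rewrite xy | dec-false (isUV? x y) ¬uv = refl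

    G-uv-vu : G-uv v u ≡ false
    G-uv-vu rewrite dec-true (isUV? v u) (inj₂ (refl , refl)) = Bool.∧-zeroʳ (adj G v u)

    R : Fin n → Bool
    R x = does (walk? G-uv x u)

    R-closed : ∀ {x y} → R x ≡ true → G-uv x y ≡ true → R y ≡ true
    R-closed {x} {y} Rx xy = dec-true (walk? G-uv y u) (step (trans (G-uv-sym y x) xy) (does⇒ (walk? G-uv x u) Rx))

    cycle-through : Walk G-uv v u → Σ (ClosedPath G) λ c → Traverses u v (ClosedPath.walk c)
    cycle-through p with toPath p
    ... | q , path , _ = record { walk = step uv q′ ; unique = unique ; long = s≤s long } , first
      where
        q′ = liftᵂ (Bool.∧-conicalˡ _ _) q
        unique : Unique (u ∷ departures q′)
        unique = subst (λ d → Unique (u ∷ d)) (sym (departures-mapᵂ q _))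
          (All.¬Any⇒All¬ _ (Path⇒end∉departures q path) ∷ Path⇒Unique-departures q path)
        long : 2 ≤ length (departures q′)
        long = subst (λ d → 2 ≤ length d) (sym (departures-mapᵂ q _)) (2≤length q (adj⇒≢ G uv ∘ sym) G-uv-vu)

    no-bridge : ¬ Walk G-uv v u → ⊥
    no-bridge ¬vu = 1+n≢n (∣1⇒≡1 (subst (2 ∣_) boundary≡1 (boundary-even G even R)))
      where
        Leaving : Fin n → Fin n → ℕ
        Leaving x y = count (R x ∧ not (R y) ∧ adj G x y)

        R-v : R v ≡ false
        R-v = dec-false (walk? G-uv v u) ¬vu

        Leaving-uv : Leaving u v ≡ 1
        Leaving-uv rewrite dec-true (walk? G-uv u u) here | R-v | uv = refl

        Leaving-zero : ∀ x y → ¬ (x ≡ u × y ≡ v) → Leaving x y ≡ 0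
        Leaving-zero x y not-uv with R x in Rx | R y in Ry | adj G x y in xy
        ... | false | _     | _     = refl
        ... | true  | true  | _     = refl
        ... | true  | false | false = refl
        ... | true  | false | true with isUV? x y
        ...   | no ¬uv                 = ⊥-elim (false≢true (trans (sym Ry) (R-closed Rx (G-uv-intro xy ¬uv))))
        ...   | yes (inj₁ (x≡u , y≡v)) = ⊥-elim (not-uv (x≡u , y≡v))
        ...   | yes (inj₂ (refl , _))  = ⊥-elim (false≢true (trans (sym R-v) Rx))

        boundary≡1 : ∑[ i < n ] ∑[ j < n ] Leaving i j ≡ 1
        boundary≡1 = begin
          ∑[ i < n ] ∑[ j < n ] Leaving i j
            ≡⟨ ∑-single (λ i → ∑[ j < n ] Leaving i j) u (λ i i≢u →
                 trans (sum-cong-≗ λ j → Leaving-zero i j (i≢u ∘ proj₁)) (sum-replicate-zero n)) ⟩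
          ∑[ j < n ] Leaving u j
            ≡⟨ ∑-single (Leaving u) v (λ j j≢v → Leaving-zero u j (j≢v ∘ proj₂)) ⟩
          Leaving u v
            ≡⟨ Leaving-uv ⟩
          1 ∎
          where open ≡-Reasoning

  edge-on-cycle : Σ (ClosedPath G) λ c → Traverses u v (ClosedPath.walk c)
  edge-on-cycle with walk? G-uv v u
  ... | yes p  = cycle-through p
  ... | no ¬vu = ⊥-elim (no-bridge ¬vu)

-- Blocks

incident-edge : ∀ {m} {G : Graph (suc (suc m))} → Connected G →
                ∀ v → Σ (Fin (suc (suc m))) λ w → adj G v w ≡ true
incident-edge connected zero    = first-step (connected zero (suc zero)) λ ()
incident-edge connected (suc v) = first-step (connected (suc v) zero) λ ()

edgeless-vertex : {G : Graph n} (H : Subgraph G) → SubConnected H → ¬ (∃₂ λ x y → F H x y ≡ true) →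
                  Fin n → Σ (Fin n) λ v → ∀ x → S H x ≡ true → x ≡ v
edgeless-vertex H connected no-edge z with Fin.any? (λ x → S H x Bool.≟ true)
... | yes (v , Hv) = v , λ x Hx → edgeless⇒start≡end no-edge (connected x v Hx Hv)
... | no no-vertex = z , λ x Hx → ⊥-elim (no-vertex (x , Hx))

-- An edgeless block would lie in a cycle through an edge at its vertex.
block-has-edge : {G : Graph n} → (∀ v → 2 ∣ degree G v) → (∀ v → Σ (Fin n) λ w → adj G v w ≡ true) →
                 Fin n →
                 (H : Subgraph G) → Block H → ∃₂ λ x y → F H x y ≡ true
block-has-edge {G = G} even incident z H (connected , _ , maximal) with edge? H
... | yes edge   = edge
... | no no-edge =
  ⊥-elim (no-edge (v₀ , w₀ , proj₂ (maximal C H⊑C (proj₁ nsC) (proj₂ nsC)) v₀ w₀ Cv₀w₀))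
  where
    vertex = edgeless-vertex H connected no-edge z
    v₀ = proj₁ vertex
    w₀ = proj₁ (incident v₀)
    through = edge-on-cycle G even (proj₂ (incident v₀))
    C = ClosedPath.subgraph (proj₁ through)
    nsC = ClosedPath.subgraph-nonseparable (proj₁ through)
    Cv₀w₀ = ClosedPath.Traverses⇒F (proj₁ through) (proj₂ through)
    H⊑C : H ⊑ C
    H⊑C = (λ x Hx → subst (λ x → S C x ≡ true) (sym (proj₂ vertex x Hx))
                          (Subgraph.F⊆S C v₀ w₀ Cv₀w₀)) ,
          (λ x y Hxy → ⊥-elim (no-edge (x , y , Hxy)))

-- The block and a cycle through one of its edges have a nonseparable union.
block-contains-cycle : {G : Graph n} → (∀ v → 2 ∣ degree G v) → (H : Subgraph G) → Block H →
                       ∃₂ (λ x y → F H x y ≡ true) → Σ (ClosedPath G) λ c → ClosedPath.subgraph c ⊑ H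
block-contains-cycle {G = G} even H (connected , noCut , maximal) (x , y , Hxy) =
  proj₁ through ,
  ⊑-trans {H = C} {K = H ∪ C} {L = H} (⊑-∪ʳ H C) (maximal (H ∪ C) (⊑-∪ˡ H C) (proj₁ H∪C) (proj₂ H∪C))
  where
    through = edge-on-cycle G even (Subgraph.F⊆E H x y Hxy)
    C = ClosedPath.subgraph (proj₁ through)
    Cxy = ClosedPath.Traverses⇒F (proj₁ through) (proj₂ through)
    H∪C = ∪-nonseparable H C (connected , noCut) (ClosedPath.subgraph-nonseparable (proj₁ through))
            (adj⇒≢ G (Subgraph.F⊆E H x y Hxy))
            (Subgraph.F⊆S H x y Hxy) (Subgraph.F⊆S H y x (trans (Subgraph.Fsym H y x) Hxy))
            (Subgraph.F⊆S C x y Cxy) (Subgraph.F⊆S C y x (trans (Subgraph.Fsym C y x) Cxy))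

odd-cycles : {G : Graph n} → (∀ k → Cycle G k → k % 4 ≡ 1) → OddCycles G
odd-cycles 1mod4 k C = trans (sym (m∣n⇒o%n%m≡o%m 2 4 k (divides 2 refl))) (cong (_% 2) (1mod4 k C))

nonseparable-isCycle : {G : Graph n} → (∀ k → Cycle G k → k % 4 ≡ 1) → (H : Subgraph G) → Nonseparable H →
                       Σ (ClosedPath G) (λ c → ClosedPath.subgraph c ⊑ H) →
                       ∃ λ k → IsCycleOfLength H k × k % 4 ≡ 1
nonseparable-isCycle 1mod4 H nonseparable (c , C⊑H) =
  ClosedPath.size c ,
  IsCycleOfLength-⊑ {H = H} {K = ClosedPath.subgraph c}
    (nonseparable⊑cycle (odd-cycles 1mod4) H nonseparable c C⊑H) C⊑H (ClosedPath.subgraph-isCycle c) ,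
  1mod4 _ (ClosedPath.cycle c)

theorem8 : (n : ℕ) → 2 ≤ n → (G : Graph n) → ε₁ G →
    (H : Subgraph G) → Block H →
    ∃ λ k → IsCycleOfLength H k × k % 4 ≡ 1
theorem8 (suc zero)    (s≤s ()) _ _ _ _
theorem8 (suc (suc m)) _ G ((connected , even) , 1mod4) H block =
  nonseparable-isCycle 1mod4 H (proj₁ block , proj₁ (proj₂ block))
    (block-contains-cycle even H block (block-has-edge even (incident-edge {G = G} connected) zero H block))
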